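{- Let $p\ge 5$ be an odd prime, $x$ a generator of $\mathbb{Z}_p^*$, $y=x^{ -1}$, and $\mathcal{I}=\mathbb{Z}_p\times\mathbb{Z}_p$. For $(a,b)\in\mathcal{I}$ let $\pi_{(a,b)}$ be the permutation of $\mathcal{I}$ given by \[ \pi_{(a,b)}((c,d)) = \begin{cases} (a, a+b+d) & \text{if } c=0 \text{ and } a+b+d\ne 0,\\ (a+xb, 0) & \text{if } c=0 \text{ and } a+b+d=0,\\ (a+c+xb, 0) & \text{if } c\ne 0 \text{ and } b+d=0,\\ (a+c, b+d) & \text{if } c\ne 0 \text{ and } b+d\ne 0,\end{cases} \] and let $\pi((c,d))=(yc,xd)$. Define $\pi^{(0)}_{(a,b)}((c,d)) = (x(a+c), y(b+d))$, \[ \pi^{(1)}_{(a,b)}((c,d)) = \begin{cases}(c, ya+d) & \text{if } c = xa,\\ (c,d) & \text{otherwise},\end{cases}\qquad \pi^{(2)}_{(a,b)}((c,d)) = \begin{cases}(c+x^2 b, d) & \text{if } d=0,\\ (c,d) & \text{otherwise}.\end{cases} \] Then for every $(a,b)\in\mathcal{I}$, \[ \pi^{ -1}\circ\pi_{(a,b)} = \pi^{(2)}_{(a,b)}\circ \pi^{(1)}_{(a,b)}\circ\pi^{(0)}_{(a,b)}. \]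
   Context: All arithmetic is in $\mathbb{Z}_p$. -}

module Defs where

open import Data.Nat as ℕ using (ℕ; NonZero)
open import Data.Nat.DivMod using (_%_; m%n<n)
open import Data.Fin as Fin using (Fin; toℕ; fromℕ<; _≟_)
open import Data.Product using (_×_; _,_; ∃)
open import Relation.Binary.PropositionalEquality using (_≡_; _≢_)
open import Relation.Nullary using (yes; no)

ℤ/ : (p : ℕ) → Set
ℤ/ p = Fin p

module Arith (p : ℕ) .{{_ : NonZero p}} where

  reduce : ℕ → ℤ/ p
  reduce n = fromℕ< (m%n<n n p)

  infixl 6 _⊕_
  infixl 7 _⊗_

  _⊕_ : ℤ/ p → ℤ/ p → ℤ/ p
  a ⊕ b = reduce (toℕ a ℕ.+ toℕ b)

  _⊗_ : ℤ/ p → ℤ/ p → ℤ/ p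
  a ⊗ b = reduce (toℕ a ℕ.* toℕ b)

  𝟘 𝟙 : ℤ/ p
  𝟘 = reduce 0
  𝟙 = reduce 1

  _^_ : ℤ/ p → ℕ → ℤ/ p
  a ^ ℕ.zero  = 𝟙
  a ^ ℕ.suc k = a ⊗ (a ^ k)

  𝓘 : Set
  𝓘 = ℤ/ p × ℤ/ p

  πab : (x : ℤ/ p) → 𝓘 → 𝓘 → 𝓘
  πab x (a , b) (c , d) with c ≟ 𝟘
  ... | yes _ with a ⊕ b ⊕ d ≟ 𝟘
  ...   | no  _ = (a , a ⊕ b ⊕ d)
  ...   | yes _ = (a ⊕ x ⊗ b , 𝟘)
  πab x (a , b) (c , d) | no _ with b ⊕ d ≟ 𝟘
  ...   | yes _ = (a ⊕ c ⊕ x ⊗ b , 𝟘)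
  ...   | no  _ = (a ⊕ c , b ⊕ d)

  π : (x y : ℤ/ p) → 𝓘 → 𝓘
  π x y (c , d) = (y ⊗ c , x ⊗ d)

  π⁽⁰⁾ : (x y : ℤ/ p) → 𝓘 → 𝓘 → 𝓘
  π⁽⁰⁾ x y (a , b) (c , d) = (x ⊗ (a ⊕ c) , y ⊗ (b ⊕ d))

  π⁽¹⁾ : (x y : ℤ/ p) → 𝓘 → 𝓘 → 𝓘
  π⁽¹⁾ x y (a , b) (c , d) with c ≟ x ⊗ a
  ... | yes _ = (c , y ⊗ a ⊕ d)
  ... | no  _ = (c , d)

  π⁽²⁾ : (x : ℤ/ p) → 𝓘 → 𝓘 → 𝓘
  π⁽²⁾ x (a , b) (c , d) with d ≟ 𝟘
  ... | yes _ = (c ⊕ x ⊗ x ⊗ b , d)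
  ... | no  _ = (c , d)

  IsGenerator : ℤ/ p → Set
  IsGenerator x = (x ≢ 𝟘) × (∀ (z : ℤ/ p) → z ≢ 𝟘 → ∃ λ k → x ^ k ≡ z)

-- Since x is invertible, the test c' = x a of π⁽¹⁾
-- on π⁽⁰⁾ (c , d) = (x (a + c) , y (b + d)) succeeds exactly when c = 0.
module Submission where

open import Defs
open import Data.Nat using (ℕ; NonZero; _≤_; _+_; _*_; _∸_; >-nonZero⁻¹)
open import Data.Nat.Primality using (Prime)
open import Data.Nat.DivMod using (_%_; %-distribˡ-+; %-distribˡ-*; m<n⇒m%n≡m; n%n≡0)
import Data.Nat.Properties as ℕ
open import Data.Fin using (toℕ; _≟_)
open import Data.Fin.Properties using (toℕ-fromℕ<; toℕ-injective; toℕ<n)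
open import Data.Product using (_,_)
open import Relation.Binary.PropositionalEquality
  using (_≡_; _≢_; refl; sym; trans; cong; cong₂; module ≡-Reasoning)
open import Relation.Nullary using (yes; no; contradiction)

module ModularArithmetic (p : ℕ) .{{_ : NonZero p}} where
  open Arith p
  open ≡-Reasoning

  toℕ-reduce : ∀ n → toℕ (reduce n) ≡ n % p
  toℕ-reduce n = toℕ-fromℕ< _

  reduce-toℕ : ∀ a → reduce (toℕ a) ≡ a
  reduce-toℕ a = toℕ-injective (trans (toℕ-reduce (toℕ a)) (m<n⇒m%n≡m (toℕ<n a)))

  reduce-+ : ∀ m n → reduce (m + n) ≡ reduce m ⊕ reduce n
  reduce-+ m n = toℕ-injective (begin
    toℕ (reduce (m + n))                            ≡⟨ toℕ-reduce (m + n) ⟩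
    (m + n) % p                                     ≡⟨ %-distribˡ-+ m n p ⟩
    (m % p + n % p) % p                             ≡⟨ cong₂ (λ u v → (u + v) % p) (sym (toℕ-reduce m)) (sym (toℕ-reduce n)) ⟩
    (toℕ (reduce m) + toℕ (reduce n)) % p           ≡⟨ sym (toℕ-reduce _) ⟩
    toℕ (reduce m ⊕ reduce n)                       ∎)

  reduce-* : ∀ m n → reduce (m * n) ≡ reduce m ⊗ reduce n
  reduce-* m n = toℕ-injective (begin
    toℕ (reduce (m * n))                            ≡⟨ toℕ-reduce (m * n) ⟩
    (m * n) % p                                     ≡⟨ %-distribˡ-* m n p ⟩
    (m % p * (n % p)) % p                           ≡⟨ cong₂ (λ u v → (u * v) % p) (sym (toℕ-reduce m)) (sym (toℕ-reduce n)) ⟩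
    (toℕ (reduce m) * toℕ (reduce n)) % p           ≡⟨ sym (toℕ-reduce _) ⟩
    toℕ (reduce m ⊗ reduce n)                       ∎)

  reduce-p : reduce p ≡ 𝟘
  reduce-p = toℕ-injective (begin
    toℕ (reduce p)  ≡⟨ toℕ-reduce p ⟩
    p % p           ≡⟨ n%n≡0 p ⟩
    0               ≡⟨ sym (m<n⇒m%n≡m (>-nonZero⁻¹ p)) ⟩
    0 % p           ≡⟨ sym (toℕ-reduce 0) ⟩
    toℕ 𝟘           ∎)

  ⊕-reduceˡ : ∀ m a → reduce m ⊕ a ≡ reduce (m + toℕ a)
  ⊕-reduceˡ m a = trans (cong (reduce m ⊕_) (sym (reduce-toℕ a))) (sym (reduce-+ m (toℕ a)))

  ⊕-reduceʳ : ∀ a n → a ⊕ reduce n ≡ reduce (toℕ a + n)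
  ⊕-reduceʳ a n = trans (cong (_⊕ reduce n) (sym (reduce-toℕ a))) (sym (reduce-+ (toℕ a) n))

  ⊗-reduceˡ : ∀ m a → reduce m ⊗ a ≡ reduce (m * toℕ a)
  ⊗-reduceˡ m a = trans (cong (reduce m ⊗_) (sym (reduce-toℕ a))) (sym (reduce-* m (toℕ a)))

  ⊗-reduceʳ : ∀ a n → a ⊗ reduce n ≡ reduce (toℕ a * n)
  ⊗-reduceʳ a n = trans (cong (_⊗ reduce n) (sym (reduce-toℕ a))) (sym (reduce-* (toℕ a) n))

  ⊕-assoc : ∀ a b c → a ⊕ b ⊕ c ≡ a ⊕ (b ⊕ c)
  ⊕-assoc a b c = begin
    reduce (toℕ a + toℕ b) ⊕ c          ≡⟨ ⊕-reduceˡ (toℕ a + toℕ b) c ⟩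
    reduce (toℕ a + toℕ b + toℕ c)      ≡⟨ cong reduce (ℕ.+-assoc (toℕ a) (toℕ b) (toℕ c)) ⟩
    reduce (toℕ a + (toℕ b + toℕ c))    ≡⟨ sym (⊕-reduceʳ a (toℕ b + toℕ c)) ⟩
    a ⊕ reduce (toℕ b + toℕ c)          ∎

  ⊕-identityˡ : ∀ a → 𝟘 ⊕ a ≡ a
  ⊕-identityˡ a = trans (⊕-reduceˡ 0 a) (reduce-toℕ a)

  ⊕-identityʳ : ∀ a → a ⊕ 𝟘 ≡ a
  ⊕-identityʳ a = trans (⊕-reduceʳ a 0) (trans (cong reduce (ℕ.+-identityʳ (toℕ a))) (reduce-toℕ a))

  ⊗-assoc : ∀ a b c → a ⊗ b ⊗ c ≡ a ⊗ (b ⊗ c)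
  ⊗-assoc a b c = begin
    reduce (toℕ a * toℕ b) ⊗ c          ≡⟨ ⊗-reduceˡ (toℕ a * toℕ b) c ⟩
    reduce (toℕ a * toℕ b * toℕ c)      ≡⟨ cong reduce (ℕ.*-assoc (toℕ a) (toℕ b) (toℕ c)) ⟩
    reduce (toℕ a * (toℕ b * toℕ c))    ≡⟨ sym (⊗-reduceʳ a (toℕ b * toℕ c)) ⟩
    a ⊗ reduce (toℕ b * toℕ c)          ∎

  ⊗-comm : ∀ a b → a ⊗ b ≡ b ⊗ a
  ⊗-comm a b = cong reduce (ℕ.*-comm (toℕ a) (toℕ b))

  ⊗-identityˡ : ∀ a → 𝟙 ⊗ a ≡ a
  ⊗-identityˡ a = trans (⊗-reduceˡ 1 a) (trans (cong reduce (ℕ.*-identityˡ (toℕ a))) (reduce-toℕ a))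

  ⊗-zeroʳ : ∀ a → a ⊗ 𝟘 ≡ 𝟘
  ⊗-zeroʳ a = trans (⊗-reduceʳ a 0) (cong reduce (ℕ.*-zeroʳ (toℕ a)))

  ⊗-distribˡ-⊕ : ∀ a b c → a ⊗ (b ⊕ c) ≡ a ⊗ b ⊕ a ⊗ c
  ⊗-distribˡ-⊕ a b c = begin
    a ⊗ reduce (toℕ b + toℕ c)                        ≡⟨ ⊗-reduceʳ a (toℕ b + toℕ c) ⟩
    reduce (toℕ a * (toℕ b + toℕ c))                  ≡⟨ cong reduce (ℕ.*-distribˡ-+ (toℕ a) (toℕ b) (toℕ c)) ⟩
    reduce (toℕ a * toℕ b + toℕ a * toℕ c)            ≡⟨ reduce-+ (toℕ a * toℕ b) (toℕ a * toℕ c) ⟩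
    a ⊗ b ⊕ a ⊗ c                                     ∎

  a⊕c≡a⇒c≡𝟘 : ∀ a c → a ⊕ c ≡ a → c ≡ 𝟘
  a⊕c≡a⇒c≡𝟘 a c a⊕c≡a = begin
    c                ≡⟨ sym (⊕-identityˡ c) ⟩
    𝟘 ⊕ c            ≡⟨ cong (_⊕ c) (sym ⊖a⊕a≡𝟘) ⟩
    ⊖a ⊕ a ⊕ c       ≡⟨ ⊕-assoc ⊖a a c ⟩
    ⊖a ⊕ (a ⊕ c)     ≡⟨ cong (⊖a ⊕_) a⊕c≡a ⟩
    ⊖a ⊕ a           ≡⟨ ⊖a⊕a≡𝟘 ⟩
    𝟘                ∎
    where
    ⊖a : ℤ/ p
    ⊖a = reduce (p ∸ toℕ a)
    ⊖a⊕a≡𝟘 : ⊖a ⊕ a ≡ 𝟘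
    ⊖a⊕a≡𝟘 = begin
      ⊖a ⊕ a                       ≡⟨ ⊕-reduceˡ (p ∸ toℕ a) a ⟩
      reduce (p ∸ toℕ a + toℕ a)   ≡⟨ cong reduce (ℕ.m∸n+n≡m (ℕ.<⇒≤ (toℕ<n a))) ⟩
      reduce p                     ≡⟨ reduce-p ⟩
      𝟘                            ∎

module Permutations (p : ℕ) .{{_ : NonZero p}} (x y : ℤ/ p) (x⊗y≡𝟙 : Arith._⊗_ p x y ≡ Arith.𝟙 p) where
  open Arith p
  open ModularArithmetic p
  open ≡-Reasoning

  x⊗[y⊗u]≡u : ∀ u → x ⊗ (y ⊗ u) ≡ u
  x⊗[y⊗u]≡u u = trans (sym (⊗-assoc x y u)) (trans (cong (_⊗ u) x⊗y≡𝟙) (⊗-identityˡ u))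

  y⊗[x⊗u]≡u : ∀ u → y ⊗ (x ⊗ u) ≡ u
  y⊗[x⊗u]≡u u = begin
    y ⊗ (x ⊗ u)    ≡⟨ sym (⊗-assoc y x u) ⟩
    y ⊗ x ⊗ u      ≡⟨ cong (_⊗ u) (trans (⊗-comm y x) x⊗y≡𝟙) ⟩
    𝟙 ⊗ u          ≡⟨ ⊗-identityˡ u ⟩
    u              ∎

  y⊗u≡𝟘⇒u≡𝟘 : ∀ u → y ⊗ u ≡ 𝟘 → u ≡ 𝟘
  y⊗u≡𝟘⇒u≡𝟘 u y⊗u≡𝟘 = trans (sym (x⊗[y⊗u]≡u u)) (trans (cong (x ⊗_) y⊗u≡𝟘) (⊗-zeroʳ x))

  x⊗-injective : ∀ u v → x ⊗ u ≡ x ⊗ v → u ≡ v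
  x⊗-injective u v x⊗u≡x⊗v = trans (sym (y⊗[x⊗u]≡u u)) (trans (cong (y ⊗_) x⊗u≡x⊗v) (y⊗[x⊗u]≡u v))

  x⊗[u⊕x⊗v]≡x⊗u⊕x⊗x⊗v : ∀ u v → x ⊗ (u ⊕ x ⊗ v) ≡ x ⊗ u ⊕ x ⊗ x ⊗ v
  x⊗[u⊕x⊗v]≡x⊗u⊕x⊗x⊗v u v = trans (⊗-distribˡ-⊕ x u (x ⊗ v)) (cong (x ⊗ u ⊕_) (sym (⊗-assoc x x v)))

  π⁽¹⁾∘π⁽⁰⁾-on-𝟘 : ∀ a b d →
    π⁽¹⁾ x y (a , b) (π⁽⁰⁾ x y (a , b) (𝟘 , d)) ≡ (x ⊗ a , y ⊗ (a ⊕ b ⊕ d))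
  π⁽¹⁾∘π⁽⁰⁾-on-𝟘 a b d with x ⊗ (a ⊕ 𝟘) ≟ x ⊗ a
  ... | yes _ = cong₂ _,_ (cong (x ⊗_) (⊕-identityʳ a))
                  (trans (sym (⊗-distribˡ-⊕ y a (b ⊕ d))) (cong (y ⊗_) (sym (⊕-assoc a b d))))
  ... | no x⊗[a⊕𝟘]≢x⊗a = contradiction (cong (x ⊗_) (⊕-identityʳ a)) x⊗[a⊕𝟘]≢x⊗a

  π⁽¹⁾∘π⁽⁰⁾-off-𝟘 : ∀ a b c d → c ≢ 𝟘 →
    π⁽¹⁾ x y (a , b) (π⁽⁰⁾ x y (a , b) (c , d)) ≡ (x ⊗ (a ⊕ c) , y ⊗ (b ⊕ d))
  π⁽¹⁾∘π⁽⁰⁾-off-𝟘 a b c d c≢𝟘 with x ⊗ (a ⊕ c) ≟ x ⊗ a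
  ... | yes x⊗[a⊕c]≡x⊗a = contradiction (a⊕c≡a⇒c≡𝟘 a c (x⊗-injective _ _ x⊗[a⊕c]≡x⊗a)) c≢𝟘
  ... | no _ = refl

  π⁽²⁾-on-𝟘 : ∀ a b u v → v ≡ 𝟘 → π⁽²⁾ x (a , b) (u , v) ≡ (u ⊕ x ⊗ x ⊗ b , v)
  π⁽²⁾-on-𝟘 a b u v v≡𝟘 with v ≟ 𝟘
  ... | yes _ = refl
  ... | no v≢𝟘 = contradiction v≡𝟘 v≢𝟘

  π⁽²⁾-off-𝟘 : ∀ a b u v → v ≢ 𝟘 → π⁽²⁾ x (a , b) (u , v) ≡ (u , v)
  π⁽²⁾-off-𝟘 a b u v v≢𝟘 with v ≟ 𝟘
  ... | yes v≡𝟘 = contradiction v≡𝟘 v≢𝟘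
  ... | no _ = refl

  module _ (πinv : 𝓘 → 𝓘) (πinv∘π≡id : ∀ z → πinv (π x y z) ≡ z) where

    πinv-formula : ∀ u v → πinv (u , v) ≡ (x ⊗ u , y ⊗ v)
    πinv-formula u v = begin
      πinv (u , v)                        ≡⟨ cong πinv (sym (cong₂ _,_ (y⊗[x⊗u]≡u u) (x⊗[y⊗u]≡u v))) ⟩
      πinv (π x y (x ⊗ u , y ⊗ v))        ≡⟨ πinv∘π≡id (x ⊗ u , y ⊗ v) ⟩
      (x ⊗ u , y ⊗ v)                     ∎

    πinv∘πab : ∀ a b c d →
      πinv (πab x (a , b) (c , d)) ≡ π⁽²⁾ x (a , b) (π⁽¹⁾ x y (a , b) (π⁽⁰⁾ x y (a , b) (c , d)))
    πinv∘πab a b c d with c ≟ 𝟘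
    πinv∘πab a b _ d | yes refl with a ⊕ b ⊕ d ≟ 𝟘
    ... | no s≢𝟘 = begin
      πinv (a , a ⊕ b ⊕ d)                          ≡⟨ πinv-formula a (a ⊕ b ⊕ d) ⟩
      (x ⊗ a , y ⊗ (a ⊕ b ⊕ d))                     ≡⟨ sym (π⁽²⁾-off-𝟘 a b _ _ (λ y⊗s≡𝟘 → s≢𝟘 (y⊗u≡𝟘⇒u≡𝟘 _ y⊗s≡𝟘))) ⟩
      π⁽²⁾ x (a , b) (x ⊗ a , y ⊗ (a ⊕ b ⊕ d))      ≡⟨ cong (π⁽²⁾ x (a , b)) (sym (π⁽¹⁾∘π⁽⁰⁾-on-𝟘 a b d)) ⟩
      _                                             ∎
    ... | yes s≡𝟘 = begin
      πinv (a ⊕ x ⊗ b , 𝟘)                          ≡⟨ πinv-formula (a ⊕ x ⊗ b) 𝟘 ⟩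
      (x ⊗ (a ⊕ x ⊗ b) , y ⊗ 𝟘)                     ≡⟨ cong₂ _,_ (x⊗[u⊕x⊗v]≡x⊗u⊕x⊗x⊗v a b) (cong (y ⊗_) (sym s≡𝟘)) ⟩
      (x ⊗ a ⊕ x ⊗ x ⊗ b , y ⊗ (a ⊕ b ⊕ d))         ≡⟨ sym (π⁽²⁾-on-𝟘 a b _ _ (trans (cong (y ⊗_) s≡𝟘) (⊗-zeroʳ y))) ⟩
      π⁽²⁾ x (a , b) (x ⊗ a , y ⊗ (a ⊕ b ⊕ d))      ≡⟨ cong (π⁽²⁾ x (a , b)) (sym (π⁽¹⁾∘π⁽⁰⁾-on-𝟘 a b d)) ⟩
      _                                             ∎
    πinv∘πab a b c d | no c≢𝟘 with b ⊕ d ≟ 𝟘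
    ... | yes t≡𝟘 = begin
      πinv (a ⊕ c ⊕ x ⊗ b , 𝟘)                      ≡⟨ πinv-formula (a ⊕ c ⊕ x ⊗ b) 𝟘 ⟩
      (x ⊗ (a ⊕ c ⊕ x ⊗ b) , y ⊗ 𝟘)                 ≡⟨ cong₂ _,_ (x⊗[u⊕x⊗v]≡x⊗u⊕x⊗x⊗v (a ⊕ c) b) (cong (y ⊗_) (sym t≡𝟘)) ⟩
      (x ⊗ (a ⊕ c) ⊕ x ⊗ x ⊗ b , y ⊗ (b ⊕ d))       ≡⟨ sym (π⁽²⁾-on-𝟘 a b _ _ (trans (cong (y ⊗_) t≡𝟘) (⊗-zeroʳ y))) ⟩
      π⁽²⁾ x (a , b) (x ⊗ (a ⊕ c) , y ⊗ (b ⊕ d))    ≡⟨ cong (π⁽²⁾ x (a , b)) (sym (π⁽¹⁾∘π⁽⁰⁾-off-𝟘 a b c d c≢𝟘)) ⟩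
      _                                             ∎
    ... | no t≢𝟘 = begin
      πinv (a ⊕ c , b ⊕ d)                          ≡⟨ πinv-formula (a ⊕ c) (b ⊕ d) ⟩
      (x ⊗ (a ⊕ c) , y ⊗ (b ⊕ d))                   ≡⟨ sym (π⁽²⁾-off-𝟘 a b _ _ (λ y⊗t≡𝟘 → t≢𝟘 (y⊗u≡𝟘⇒u≡𝟘 _ y⊗t≡𝟘))) ⟩
      π⁽²⁾ x (a , b) (x ⊗ (a ⊕ c) , y ⊗ (b ⊕ d))    ≡⟨ cong (π⁽²⁾ x (a , b)) (sym (π⁽¹⁾∘π⁽⁰⁾-off-𝟘 a b c d c≢𝟘)) ⟩
      _                                             ∎

proposition2 : (p : ℕ) → .{{_ : NonZero p}} → Prime p → 5 ≤ p →
    (x y : ℤ/ p) → Arith.IsGenerator p x → Arith._⊗_ p x y ≡ Arith.𝟙 p →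
    (πinv : Arith.𝓘 p → Arith.𝓘 p) →
    (∀ z → πinv (Arith.π p x y z) ≡ z) → (∀ z → Arith.π p x y (πinv z) ≡ z) →
    ∀ (a b c d : ℤ/ p) →
      πinv (Arith.πab p x (a , b) (c , d))
        ≡ Arith.π⁽²⁾ p x (a , b) (Arith.π⁽¹⁾ p x y (a , b) (Arith.π⁽⁰⁾ p x y (a , b) (c , d)))
proposition2 p _ _ x y _ x⊗y≡𝟙 πinv πinv∘π≡id _ = Permutations.πinv∘πab p x y x⊗y≡𝟙 πinv πinv∘π≡id
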